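{- For any graph $G$ on $n\ge 1$ vertices, $b_2(G\circ K_1)=t_2(G\circ K_1)=n+1$.
   Context: Throughout, all graphs are finite and connected. The corona $G\circ K_1$ is the graph on $2n$ vertices obtained from $G$ by attaching to each vertex of $G$ a new pendant vertex (leaf) adjacent only to it. The 2-burning process: given a graph $G$ and a sequence $s=(s_1,\dots,s_k)$ of vertices of $G$ (sources), at round $0$ all vertices are uncolored; at each round $j\ge1$, (i) if $j\le k$ and $s_j$ is uncolored, $s_j$ is colored blue, and (ii) every uncolored vertex having at least two neighbors that were blue at the end of round $j-1$ is colored blue. $s$ is a 2-burning sequence if eventually all vertices are blue; $\mathrm{len}(s)=k$ and $\mathrm{rd}(s)$ is the first round at the end of which all vertices are blue. $b_2(G)$ is the minimum of $\mathrm{rd}(s)$ over all 2-burning sequences; a 2-burning sequence achieving it is optimal; $t_2(G)$ is the minimum length of an optimal 2-burning sequence. -}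

module Defs where

open import Data.Nat using (ℕ; zero; suc; _+_; _≤_; _<_; _≤ᵇ_)
open import Data.Fin using (Fin; splitAt; _≟_)
import Data.Fin as F
open import Data.Bool using (Bool; true; false; _∨_; _∧_; if_then_else_)
open import Data.Sum using (_⊎_; inj₁; inj₂)
open import Data.List using (List; []; _∷_; length)
open import Data.Product using (Σ; _×_; _,_)
open import Relation.Binary.PropositionalEquality using (_≡_)
open import Relation.Nullary using (¬_)
open import Relation.Nullary.Decidable using (⌊_⌋)

Graph : ℕ → Set
Graph n = Fin n → Fin n → Bool

IsSimple : {n : ℕ} → Graph n → Set
IsSimple {n} G = (∀ u v → G u v ≡ G v u) × (∀ v → G v v ≡ false)

data Reach {n : ℕ} (G : Graph n) : Fin n → Fin n → Set where
  here : ∀ {v} → Reach G v v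
  step : ∀ {u w v} → G u w ≡ true → Reach G w v → Reach G u v

IsConnected : {n : ℕ} → Graph n → Set
IsConnected {n} G = ∀ u v → Reach G u v

-- Corona G ∘ K₁ on n + n vertices: the first n copies are the vertices of G,
-- vertex (n + i) is a leaf attached to vertex i.
coronaAdj : {n : ℕ} → Graph n → Fin n ⊎ Fin n → Fin n ⊎ Fin n → Bool
coronaAdj G (inj₁ a) (inj₁ b) = G a b
coronaAdj G (inj₁ a) (inj₂ b) = ⌊ a ≟ b ⌋
coronaAdj G (inj₂ a) (inj₁ b) = ⌊ a ≟ b ⌋
coronaAdj G (inj₂ a) (inj₂ b) = false

corona : {n : ℕ} → Graph n → Graph (n + n)
corona {n} G u v = coronaAdj G (splitAt n u) (splitAt n v)

count : {m : ℕ} → (Fin m → Bool) → ℕ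
count {zero} p = 0
count {suc m} p = (if p F.zero then 1 else 0) + count (λ i → p (F.suc i))

-- isSrc s j v : v is the (j+1)-th source s_{j+1} of the sequence s
isSrc : {m : ℕ} → List (Fin m) → ℕ → Fin m → Bool
isSrc [] j v = false
isSrc (x ∷ s) zero v = ⌊ x ≟ v ⌋
isSrc (x ∷ s) (suc j) v = isSrc s j v

-- blue G s j v : v is blue at the end of round j of the 2-burning process
blue : {m : ℕ} → Graph m → List (Fin m) → ℕ → Fin m → Bool
blue G s zero v = false
blue G s (suc j) v =
  blue G s j v ∨ (isSrc s j v ∨ (2 ≤ᵇ count (λ w → G v w ∧ blue G s j w)))

AllBlue : {m : ℕ} → Graph m → List (Fin m) → ℕ → Set
AllBlue G s r = ∀ v → blue G s r v ≡ true

-- rd(s) = r : r is the first round at whose end all vertices are blue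
-- (in particular s is a 2-burning sequence)
Rd : {m : ℕ} → Graph m → List (Fin m) → ℕ → Set
Rd G s r = AllBlue G s r × (∀ r' → r' < r → ¬ AllBlue G s r')

IsB2 : {m : ℕ} → Graph m → ℕ → Set
IsB2 {m} G b = Σ (List (Fin m)) (λ s → Rd G s b) × (∀ s r → Rd G s r → b ≤ r)

IsT2 : {m : ℕ} → Graph m → ℕ → ℕ → Set
IsT2 {m} G b t =
  Σ (List (Fin m)) (λ s → Rd G s b × length s ≡ t) × (∀ s → Rd G s b → t ≤ length s)

{-# OPTIONS --safe #-}
module Submission where

-- A leaf of G ∘ K₁ has a single neighbour, so it can only turn blue as a source; and the
-- first vertex of G to turn blue has at most one blue neighbour (its own leaf), so it is a
-- source too. Every 2-burning sequence therefore has at least n + 1 distinct sources, each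
-- placed at its own round, so both its length and its number of rounds are at least n + 1.
-- Conversely, as G is connected its vertices can be listed as r = v₁, v₂, …, vₙ with each vᵢ
-- (i ≥ 2) adjacent to an earlier one; the sequence r, leaf v₂, …, leaf vₙ, leaf r turns vᵢ
-- blue at round i + 1, when both its leaf and an earlier neighbour are blue.

open import Defs
open import Data.Bool using (Bool; true; false; _∨_; _∧_; T)
open import Data.Bool.Properties using (T-≡; T-∨; T-∧)
open import Data.Empty using (⊥-elim)
open import Data.Fin using (Fin; _≟_; _↑ˡ_; _↑ʳ_; splitAt; fromℕ<)
import Data.Fin as F
open import Data.Fin.Properties
  using (any?; injective⇒≤; fromℕ<-injective; splitAt-↑ˡ; splitAt-↑ʳ; splitAt⁻¹-↑ˡ; splitAt⁻¹-↑ʳ;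
         ↑ʳ-injective)
open import Data.List using (List; []; _∷_; _∷ʳ_; _++_; length)
open import Data.List.Properties using (length-++-comm)
open import Data.List.Relation.Unary.Any using (here; there)
open import Data.List.Membership.Propositional using (_∈_; _∉_)
import Data.List.Membership.DecPropositional as DecMembership
open import Data.Nat using (ℕ; zero; suc; _+_; _≤_; _<_; _≥_; z≤n; s≤s)
open import Data.Nat.Properties
  using (≤-refl; ≤-trans; ≤-reflexive; ≤-pred; m≤n⇒m≤1+n; m<n⇒m<1+n; n<1+n; <-trans; <-irrefl;
         ≤⇒≯; <⇒≱; ≤ᵇ⇒≤; ≤⇒≤ᵇ)
open import Data.Product using (_×_; _,_; proj₁; proj₂; ∃-syntax)
import Data.Product as Product
open import Data.Sum using (_⊎_; inj₁; inj₂)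
import Data.Sum as Sum
open import Function using (_∘_; id; Equivalence)
open import Function.Definitions using (Injective)
open import Relation.Binary.PropositionalEquality
  using (_≡_; _≢_; refl; sym; trans; cong; cong₂; subst)
open import Relation.Nullary using (¬_; Dec; yes; no; does)
open import Relation.Nullary.Decidable using (⌊_⌋; toWitness; fromWitness; T?; _×-dec_)
open import Relation.Unary using (Decidable)

open Equivalence using (to; from)

-- Unlike ⌊_⌋, which toWitness works with, does computes through Dec.map′: for instance
-- does (v ∈? u ∷ vs) unfolds to does (v ≟ u) ∨ does (v ∈? vs).
does-sound : ∀ {A : Set} (a? : Dec A) → T (does a?) → A
does-sound (yes a) _ = a

does-complete : ∀ {A : Set} (a? : Dec A) → A → T (does a?)
does-complete (yes _) _ = _
does-complete (no ¬a) a = ¬a a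

count-none : ∀ {m} → count {m} (λ _ → false) ≡ 0
count-none {zero} = refl
count-none {suc m} = count-none {m}

count-insert : ∀ {m} {p : Fin m → Bool} u → ¬ T (p u) →
  count (λ v → does (v ≟ u) ∨ p v) ≡ suc (count p)
count-insert {suc m} {p} F.zero ¬pu with p F.zero | ¬pu
... | false | _ = refl
... | true | ¬t = ⊥-elim (¬t _)
count-insert {suc m} {p} (F.suc u) ¬pu with p F.zero
... | false = count-insert u ¬pu
... | true = cong suc (count-insert u ¬pu)

count-mono : ∀ {m} {p q : Fin m → Bool} → (∀ v → T (p v) → T (q v)) → count p ≤ count q
count-mono {zero} _ = z≤n
count-mono {suc m} {p} {q} p⊆q with p F.zero | q F.zero | p⊆q F.zero
... | false | false | _ = count-mono (p⊆q ∘ F.suc)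
... | false | true  | _ = m≤n⇒m≤1+n (count-mono (p⊆q ∘ F.suc))
... | true  | true  | _ = s≤s (count-mono (p⊆q ∘ F.suc))
... | true  | false | p0⇒q0 = ⊥-elim (p0⇒q0 _)

count-≟ : ∀ {m} (x : Fin m) → count (λ v → does (v ≟ x)) ≡ 1
count-≟ {suc m} F.zero = cong suc (count-none {m})
count-≟ (F.suc x) = count-≟ x

count≤1 : ∀ {m} {p : Fin m → Bool} x → (∀ w → T (p w) → w ≡ x) → count p ≤ 1
count≤1 x only =
  ≤-trans (count-mono (λ w pw → does-complete (w ≟ x) (only w pw))) (≤-reflexive (count-≟ x))

count≥2 : ∀ {m} {p : Fin m → Bool} {x y} → x ≢ y → T (p x) → T (p y) → 2 ≤ count p
count≥2 {p = p} {x} {y} x≢y px py = ≤-trans (≤-reflexive (sym count-pair)) (count-mono pair⊆p)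
  where
  count-pair : count (λ v → does (v ≟ x) ∨ does (v ≟ y)) ≡ 2
  count-pair = trans (count-insert x (x≢y ∘ does-sound (x ≟ y))) (cong suc (count-≟ y))
  pair⊆p : ∀ v → T (does (v ≟ x) ∨ does (v ≟ y)) → T (p v)
  pair⊆p v t with to T-∨ t
  ... | inj₁ v≡x = subst (T ∘ p) (sym (does-sound (v ≟ x) v≡x)) px
  ... | inj₂ v≡y = subst (T ∘ p) (sym (does-sound (v ≟ y) v≡y)) py

count≤m : ∀ {m} (p : Fin m → Bool) → count p ≤ m
count≤m {zero} p = z≤n
count≤m {suc m} p with p F.zero
... | true = s≤s (count≤m (p ∘ F.suc))
... | false = m≤n⇒m≤1+n (count≤m (p ∘ F.suc))

count<m : ∀ {m} {p : Fin m → Bool} v → ¬ T (p v) → count p < m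
count<m {suc m} {p} F.zero ¬pv with p F.zero | ¬pv
... | false | _ = s≤s (count≤m (p ∘ F.suc))
... | true | ¬t = ⊥-elim (¬t _)
count<m {suc m} {p} (F.suc v) ¬pv with p F.zero
... | true = s≤s (count<m v ¬pv)
... | false = m≤n⇒m≤1+n (count<m v ¬pv)

count≡m⇒all : ∀ {m} {p : Fin m → Bool} → count p ≡ m → ∀ v → T (p v)
count≡m⇒all {p = p} full v with T? (p v)
... | yes pv = pv
... | no ¬pv = ⊥-elim (<-irrefl full (count<m v ¬pv))

count<m⇒∃ : ∀ {m} {p : Fin m → Bool} → count p < m → ∃[ v ] ¬ T (p v)
count<m⇒∃ {suc m} {p} c<m with p F.zero in p0
... | false = F.zero , subst T p0
... | true = Product.map F.suc id (count<m⇒∃ (≤-pred c<m))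

isSrc-unique : ∀ {m} (s : List (Fin m)) j {a b} → T (isSrc s j a) → T (isSrc s j b) → a ≡ b
isSrc-unique (x ∷ s) zero src-a src-b = trans (sym (toWitness src-a)) (toWitness src-b)
isSrc-unique (x ∷ s) (suc j) = isSrc-unique s j

isSrc⇒< : ∀ {m} (s : List (Fin m)) j {a} → T (isSrc s j a) → j < length s
isSrc⇒< (x ∷ s) zero _ = s≤s z≤n
isSrc⇒< (x ∷ s) (suc j) src = s≤s (isSrc⇒< s j src)

isSrc-++ : ∀ {m} (s q : List (Fin m)) j {a} → T (isSrc s j a) → T (isSrc (s ++ q) j a)
isSrc-++ (x ∷ s) q zero src = src
isSrc-++ (x ∷ s) q (suc j) src = isSrc-++ s q j src

isSrc-∷ʳ : ∀ {m} (s : List (Fin m)) x → T (isSrc (s ∷ʳ x) (length s) x)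
isSrc-∷ʳ [] x = fromWitness refl
isSrc-∷ʳ (y ∷ s) x = isSrc-∷ʳ s x

-- The round is an explicit argument of the lemmas below: blue recurses on it, so it cannot be
-- inferred from a goal T (blue H s j v).
module _ {m : ℕ} (H : Graph m) where

  blueDegree : List (Fin m) → ℕ → Fin m → ℕ
  blueDegree s j v = count (λ w → H v w ∧ blue H s j w)

  blue-step : ∀ s j {v} → T (blue H s j v) → T (blue H s (suc j) v)
  blue-step s j b = from T-∨ (inj₁ b)

  isSrc⇒blue : ∀ s j {v} → T (isSrc s j v) → T (blue H s (suc j) v)
  isSrc⇒blue s j {v} src = from (T-∨ {blue H s j v}) (inj₂ (from (T-∨ {isSrc s j v}) (inj₁ src)))

  spread⇒blue : ∀ s j {v} → 2 ≤ blueDegree s j v → T (blue H s (suc j) v)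
  spread⇒blue s j {v} d =
    from (T-∨ {blue H s j v}) (inj₂ (from (T-∨ {isSrc s j v}) (inj₂ (≤⇒≤ᵇ d))))

  blue-suc⁻ : ∀ s j {v} → T (blue H s (suc j) v) →
    T (blue H s j v) ⊎ T (isSrc s j v) ⊎ 2 ≤ blueDegree s j v
  blue-suc⁻ s j b = Sum.map₂ (Sum.map₂ (≤ᵇ⇒≤ 2 _) ∘ to T-∨) (to T-∨ b)

  blue-++ : ∀ s q j {v} → T (blue H s j v) → T (blue H (s ++ q) j v)
  blue-++ s q (suc j) {v} b with blue-suc⁻ s j b
  ... | inj₁ b′ = blue-step (s ++ q) j (blue-++ s q j b′)
  ... | inj₂ (inj₁ src) = isSrc⇒blue (s ++ q) j (isSrc-++ s q j src)
  ... | inj₂ (inj₂ d) = spread⇒blue (s ++ q) j (≤-trans d (count-mono extend))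
    where
    extend : ∀ w → T (H v w ∧ blue H s j w) → T (H v w ∧ blue H (s ++ q) j w)
    extend w = from T-∧ ∘ Product.map₂ (blue-++ s q j) ∘ to T-∧

AtMostOneExit : ∀ {m} → Graph m → (Fin m → Set) → Set
AtMostOneExit H P = ∀ {v} → P v → ∃[ x ] ∀ w → T (H v w) → ¬ P w → w ≡ x

module _ {m : ℕ} (H : Graph m) {P : Fin m → Set} (P? : Decidable P) (exit : AtMostOneExit H P)
  where

  blueNeighbour-inside : ∀ {b : Fin m → Bool} {v} → P v → 2 ≤ count (λ w → H v w ∧ b w) →
    ∃[ w ] P w × T (b w)
  blueNeighbour-inside {b} {v} Pv d with any? (λ w → P? w ×-dec T? (H v w ∧ b w))
  ... | yes (w , Pw , hb) = w , Pw , proj₂ (to T-∧ hb)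
  ... | no none = ⊥-elim (≤⇒≯ (count≤1 (proj₁ (exit Pv)) outside⇒exit) d)
    where
    outside⇒exit : ∀ w → T (H v w ∧ b w) → w ≡ proj₁ (exit Pv)
    outside⇒exit w hb = proj₂ (exit Pv) w (proj₁ (to T-∧ hb)) (λ Pw → none (w , Pw , hb))

  blue-suc⁻-inside : ∀ s r {v} → P v → T (blue H s (suc r) v) →
    T (isSrc s r v) ⊎ ∃[ w ] P w × T (blue H s r w)
  blue-suc⁻-inside s r Pv b with blue-suc⁻ H s r b
  ... | inj₁ b′ = inj₂ (_ , Pv , b′)
  ... | inj₂ (inj₁ src) = inj₁ src
  ... | inj₂ (inj₂ d) = inj₂ (blueNeighbour-inside Pv d)

  blue⇒source : ∀ s r {v} → P v → T (blue H s r v) → ∃[ j ] ∃[ u ] j < r × P u × T (isSrc s j u)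
  blue⇒source s (suc r) Pv b with blue-suc⁻-inside s r Pv b
  ... | inj₁ src = r , _ , ≤-refl , Pv , src
  ... | inj₂ (w , Pw , bw) =
    Product.map₂ (Product.map₂ (Product.map₁ m<n⇒m<1+n)) (blue⇒source s r Pw bw)

distinctSources⇒≤ : ∀ {m k b} (s : List (Fin m)) {u : Fin k → Fin m} {j : Fin k → ℕ} →
  Injective _≡_ _≡_ u → (∀ x → T (isSrc s (j x) (u x))) → (∀ x → j x < b) → k ≤ b
distinctSources⇒≤ s {u} {j} u-injective src j<b = injective⇒≤ round-injective
  where
  round-injective : ∀ {x y} → fromℕ< (j<b x) ≡ fromℕ< (j<b y) → x ≡ y
  round-injective {x} {y} eq = u-injective (isSrc-unique s (j x) (src x) src-y)
    where
    src-y : T (isSrc s (j x) (u y))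
    src-y = subst (λ i → T (isSrc s i (u y)))
                  (sym (fromℕ<-injective (j x) (j y) (j<b x) (j<b y) eq)) (src y)

module _ {n : ℕ} where
  open DecMembership (_≟_ {n}) using (_∈?_)

  _∈ᵇ_ : Fin n → List (Fin n) → Bool
  v ∈ᵇ vs = does (v ∈? vs)

  ∈ᵇ⇒∈ : ∀ {v vs} → T (v ∈ᵇ vs) → v ∈ vs
  ∈ᵇ⇒∈ = does-sound (_ ∈? _)

  ∈⇒∈ᵇ : ∀ {v vs} → v ∈ vs → T (v ∈ᵇ vs)
  ∈⇒∈ᵇ = does-complete (_ ∈? _)

  crossingEdge : ∀ {G : Graph n} {vs a v} → Reach G a v → a ∈ vs → v ∉ vs →
    ∃[ w ] ∃[ u ] w ∈ vs × u ∉ vs × T (G w u)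
  crossingEdge here a∈ v∉ = ⊥-elim (v∉ a∈)
  crossingEdge {vs = vs} (step {w = u} Gau walk) a∈ v∉ with u ∈? vs
  ... | yes u∈ = crossingEdge walk u∈ v∉
  ... | no u∉ = _ , u , a∈ , u∉ , from T-≡ Gau

module _ {n : ℕ} (G : Graph n) where

  data Exploration (r : Fin n) : List (Fin n) → Set where
    start : Exploration r (r ∷ [])
    visit : ∀ {vs w u} → Exploration r vs → w ∈ vs → T (G w u) → Exploration r (u ∷ vs)

  root∈ : ∀ {r vs} → Exploration r vs → r ∈ vs
  root∈ start = here refl
  root∈ (visit e _ _) = there (root∈ e)

  -- The count invariant says that vs has no repetitions.
  explore : ∀ {r} → (∀ v → Reach G r v) → ∀ k → k < n →
    ∃[ vs ] Exploration r vs × length vs ≡ suc k × count (_∈ᵇ vs) ≡ suc k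
  explore {r} _ zero _ =
    r ∷ [] , start , refl , trans (count-insert {p = _∈ᵇ []} r (λ ())) (cong suc (count-none {n}))
  explore reachable (suc k) k<n with explore reachable k (<-trans (n<1+n k) k<n)
  ... | vs , e , length≡ , count≡ with count<m⇒∃ (subst (_< n) (sym count≡) k<n)
  ... | v , v∉ with crossingEdge (reachable v) (root∈ e) (v∉ ∘ ∈⇒∈ᵇ)
  ... | w , u , w∈ , u∉ , Gwu =
    u ∷ vs , visit e w∈ Gwu , cong suc length≡ ,
    trans (count-insert {p = _∈ᵇ vs} u (u∉ ∘ ∈ᵇ⇒∈)) (cong suc count≡)

exploration : ∀ {n} (G : Graph n) {r} → (∀ v → Reach G r v) →
  ∃[ vs ] Exploration G r vs × length vs ≡ n × ∀ v → v ∈ vs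
exploration {suc n} G reachable with explore G reachable n ≤-refl
... | vs , e , length≡ , count≡ = vs , e , length≡ , ∈ᵇ⇒∈ ∘ count≡m⇒all count≡

module Corona {n : ℕ} (G : Graph n) where

  C : Graph (n + n)
  C = corona G

  core leaf : Fin n → Fin (n + n)
  core a = a ↑ˡ n
  leaf a = n ↑ʳ a

  data CoronaVertex : Fin (n + n) → Set where
    isCore : ∀ a → CoronaVertex (core a)
    isLeaf : ∀ a → CoronaVertex (leaf a)

  coronaVertex : ∀ w → CoronaVertex w
  coronaVertex w with splitAt n w in split≡
  ... | inj₁ a = subst CoronaVertex (splitAt⁻¹-↑ˡ split≡) (isCore a)
  ... | inj₂ a = subst CoronaVertex (splitAt⁻¹-↑ʳ split≡) (isLeaf a)

  core≢leaf : ∀ {a b} → core a ≢ leaf b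
  core≢leaf {a} {b} eq
    with () ← trans (sym (splitAt-↑ˡ n a n)) (trans (cong (splitAt n) eq) (splitAt-↑ʳ n n b))

  core-core : ∀ a b → C (core a) (core b) ≡ G a b
  core-core a b = cong₂ (coronaAdj G) (splitAt-↑ˡ n a n) (splitAt-↑ˡ n b n)

  core-leaf : ∀ a b → C (core a) (leaf b) ≡ ⌊ a ≟ b ⌋
  core-leaf a b = cong₂ (coronaAdj G) (splitAt-↑ˡ n a n) (splitAt-↑ʳ n n b)

  leaf-core : ∀ a b → C (leaf a) (core b) ≡ ⌊ a ≟ b ⌋
  leaf-core a b = cong₂ (coronaAdj G) (splitAt-↑ʳ n n a) (splitAt-↑ˡ n b n)

  leaf-leaf : ∀ a b → C (leaf a) (leaf b) ≡ false
  leaf-leaf a b = cong₂ (coronaAdj G) (splitAt-↑ʳ n n a) (splitAt-↑ʳ n n b)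

  IsCore : Fin (n + n) → Set
  IsCore w = ∃[ a ] w ≡ core a

  isCore? : Decidable IsCore
  isCore? w with coronaVertex w
  ... | isCore a = yes (a , refl)
  ... | isLeaf a = no λ (b , eq) → core≢leaf (sym eq)

  cores-atMostOneExit : AtMostOneExit C IsCore
  cores-atMostOneExit (a , refl) = leaf a , exit
    where
    exit : ∀ w → T (C (core a) w) → ¬ IsCore w → w ≡ leaf a
    exit w adj notCore with coronaVertex w
    ... | isCore b = ⊥-elim (notCore (b , refl))
    ... | isLeaf b = cong leaf (sym (toWitness (subst T (core-leaf a b) adj)))

  leaf-atMostOneExit : ∀ a → AtMostOneExit C (_≡ leaf a)
  leaf-atMostOneExit a refl = core a , λ w adj _ → neighbour w adj
    where
    neighbour : ∀ w → T (C (leaf a) w) → w ≡ core a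
    neighbour w adj with coronaVertex w
    ... | isCore b = cong core (sym (toWitness (subst T (leaf-core a b) adj)))
    ... | isLeaf b = ⊥-elim (subst T (leaf-leaf a b) adj)

  blueCore⇒coreSource : ∀ s r {a} → T (blue C s r (core a)) →
    ∃[ j ] ∃[ u ] j < r × IsCore u × T (isSrc s j u)
  blueCore⇒coreSource s r = blue⇒source C isCore? cores-atMostOneExit s r (_ , refl)

  blueLeaf⇒source : ∀ s r {a} → T (blue C s r (leaf a)) → ∃[ j ] j < r × T (isSrc s j (leaf a))
  blueLeaf⇒source s r {a} b with blue⇒source C (_≟ leaf a) (leaf-atMostOneExit a) s r refl b
  ... | j , _ , j<r , refl , src = j , j<r , src

  allBlue⇒bound : ∀ s r {b} → Fin n → AllBlue C s r →
    (∀ {j u} → j < r → T (isSrc s j u) → j < b) → suc n ≤ b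
  allBlue⇒bound s r a allBlue bound with blueCore⇒coreSource s r (from T-≡ (allBlue (core a)))
  ... | j₀ , _ , j₀<r , (c , refl) , src₀ =
    distinctSources⇒≤ s source-injective source-isSrc (λ x → bound (round<r x) (source-isSrc x))
    where
    leafSource : ∀ a → ∃[ j ] j < r × T (isSrc s j (leaf a))
    leafSource a = blueLeaf⇒source s r (from T-≡ (allBlue (leaf a)))

    source : Fin (suc n) → Fin (n + n)
    source F.zero = core c
    source (F.suc a) = leaf a

    round : Fin (suc n) → ℕ
    round F.zero = j₀
    round (F.suc a) = proj₁ (leafSource a)

    round<r : ∀ x → round x < r
    round<r F.zero = j₀<r
    round<r (F.suc a) = proj₁ (proj₂ (leafSource a))

    source-isSrc : ∀ x → T (isSrc s (round x) (source x))
    source-isSrc F.zero = src₀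
    source-isSrc (F.suc a) = proj₂ (proj₂ (leafSource a))

    source-injective : Injective _≡_ _≡_ source
    source-injective {F.zero} {F.zero} _ = refl
    source-injective {F.zero} {F.suc b} eq = ⊥-elim (core≢leaf eq)
    source-injective {F.suc a} {F.zero} eq = ⊥-elim (core≢leaf (sym eq))
    source-injective {F.suc a} {F.suc b} eq = cong F.suc (↑ʳ-injective n a b eq)

  allBlue⇒rounds≥ : ∀ s r → Fin n → AllBlue C s r → suc n ≤ r
  allBlue⇒rounds≥ s r a allBlue = allBlue⇒bound s r a allBlue (λ j<r _ → j<r)

  allBlue⇒length≥ : ∀ s r → Fin n → AllBlue C s r → suc n ≤ length s
  allBlue⇒length≥ s r a allBlue = allBlue⇒bound s r a allBlue (λ {j} _ → isSrc⇒< s j)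

  prefix : ∀ {r vs} → Exploration G r vs → List (Fin (n + n))
  prefix {r} start = core r ∷ []
  prefix (visit {u = u} e _ _) = prefix e ∷ʳ leaf u

  length-prefix : ∀ {r vs} (e : Exploration G r vs) → length (prefix e) ≡ length vs
  length-prefix start = refl
  length-prefix (visit {u = u} e _ _) =
    trans (length-++-comm (prefix e) (leaf u ∷ [])) (cong suc (length-prefix e))

  isSrc-after-prefix : ∀ {r vs} (e : Exploration G r vs) x →
    T (isSrc (prefix e ∷ʳ x) (length vs) x)
  isSrc-after-prefix e x =
    subst (λ j → T (isSrc (prefix e ∷ʳ x) j x)) (length-prefix e) (isSrc-∷ʳ (prefix e) x)

  prefix-leaves : ∀ {r vs v} (e : Exploration G r vs) → v ∈ vs →
    v ≡ r ⊎ T (blue C (prefix e) (length vs) (leaf v))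
  prefix-leaves start (here refl) = inj₁ refl
  prefix-leaves {vs = _ ∷ vs} (visit e _ _) (here refl) =
    inj₂ (isSrc⇒blue C _ (length vs) (isSrc-after-prefix e _))
  prefix-leaves {vs = _ ∷ vs} (visit e _ _) (there v∈) =
    Sum.map₂ (blue-step C _ (length vs) ∘ blue-++ C (prefix e) _ (length vs)) (prefix-leaves e v∈)

  module _ (symmetric : ∀ a b → G a b ≡ G b a) where

    prefix-cores : ∀ {r vs v} (e : Exploration G r vs) → v ∈ vs →
      T (blue C (prefix e) (suc (length vs)) (core v))
    prefix-cores {r} start (here refl) =
      blue-step C (core r ∷ []) 1 (isSrc⇒blue C (core r ∷ []) 0 (fromWitness refl))
    prefix-cores {vs = _ ∷ vs} (visit {w = w} {u} e w∈ Gwu) (here refl) =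
      spread⇒blue C _ (suc (length vs)) (count≥2 (core≢leaf ∘ sym) leaf-blue core-blue)
      where
      s′ : List (Fin (n + n))
      s′ = prefix e ∷ʳ leaf u
      leaf-blue : T (C (core u) (leaf u) ∧ blue C s′ (suc (length vs)) (leaf u))
      leaf-blue = from T-∧ ( subst T (sym (core-leaf u u)) (fromWitness refl)
                           , isSrc⇒blue C s′ (length vs) (isSrc-after-prefix e (leaf u)))
      core-blue : T (C (core u) (core w) ∧ blue C s′ (suc (length vs)) (core w))
      core-blue = from T-∧ ( subst T (sym (trans (core-core u w) (symmetric u w))) Gwu
                           , blue-++ C (prefix e) _ (suc (length vs)) (prefix-cores e w∈))
    prefix-cores {vs = _ ∷ vs} (visit e _ _) (there v∈) =
      blue-step C _ (suc (length vs)) (blue-++ C (prefix e) _ (suc (length vs)) (prefix-cores e v∈))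

    burningSequence : ∀ {r vs} → Exploration G r vs → List (Fin (n + n))
    burningSequence {r} e = prefix e ∷ʳ leaf r

    length-burningSequence : ∀ {r vs} (e : Exploration G r vs) →
      length (burningSequence e) ≡ suc (length vs)
    length-burningSequence {r} e =
      trans (length-++-comm (prefix e) (leaf r ∷ [])) (cong suc (length-prefix e))

    burningSequence-allBlue : ∀ {r vs} (e : Exploration G r vs) → (∀ v → v ∈ vs) →
      ∀ w → T (blue C (burningSequence e) (suc (length vs)) w)
    burningSequence-allBlue {vs = vs} e covers w with coronaVertex w
    ... | isCore v = blue-++ C (prefix e) _ (suc (length vs)) (prefix-cores e (covers v))
    ... | isLeaf v with prefix-leaves e (covers v)
    ...   | inj₁ refl = isSrc⇒blue C _ (length vs) (isSrc-after-prefix e (leaf v))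
    ...   | inj₂ b = blue-step C _ (length vs) (blue-++ C (prefix e) _ (length vs) b)

    burningSequence-rd : ∀ {r vs} (e : Exploration G r vs) → length vs ≡ n → (∀ v → v ∈ vs) →
      Rd C (burningSequence e) (suc n)
    burningSequence-rd {r} e length≡ covers =
      allBlue , λ r′ r′<1+n allBlue′ → <⇒≱ r′<1+n (allBlue⇒rounds≥ s r′ r allBlue′)
      where
      s : List (Fin (n + n))
      s = burningSequence e
      allBlue : AllBlue C s (suc n)
      allBlue w = to T-≡ (subst (λ k → T (blue C s (suc k) w)) length≡ (burningSequence-allBlue e covers w))

proposition1 : (n : ℕ) → n ≥ 1 → (G : Graph n) → IsSimple G → IsConnected G →
    IsB2 (corona G) (suc n) × IsT2 (corona G) (suc n) (suc n)
proposition1 (suc n) _ G (symmetric , _) connected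
  with vs , e , length≡ , covers ← exploration G (connected F.zero) =
  ((s , rd) , λ s′ r′ → allBlue⇒rounds≥ s′ r′ F.zero ∘ proj₁) ,
  ((s , rd , length-s) , λ s′ → allBlue⇒length≥ s′ (suc (suc n)) F.zero ∘ proj₁)
  where
  open Corona G
  s : List (Fin (suc n + suc n))
  s = burningSequence symmetric e
  rd : Rd C s (suc (suc n))
  rd = burningSequence-rd symmetric e length≡ covers
  length-s : length s ≡ suc (suc n)
  length-s = trans (length-burningSequence symmetric e) (cong suc length≡)
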